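{- Let $n\ge 5$ and $p\le n-2$. Then every $p$-cycle $c$ in the simplicial chain complex (with integer coefficients) of $\Delta_n=\mathcal{VR}(\mathbb{I}_n;3)$ is homologous in $\Delta_n$ to a $p$-cycle $\tilde c$ supported in the subcomplex $\partial(\Delta_n)$.
   Context: $\mathbb{I}_n$ is the graph on $\{0,1\}^n$, two strings adjacent iff they differ in exactly one coordinate; distance is the number of differing coordinates. $\Delta_n=\mathcal{VR}(\mathbb{I}_n;3)$ is the simplicial complex whose simplices are the sets of vertices with pairwise distance at most $3$. For $i\in[n]$ and $\epsilon\in\{0,1\}$, $\mathbb{I}_n^{(i,\epsilon)}$ is the induced subgraph on $\{v: v(i)=\epsilon\}$, where $v(i)$ is the $i$-th coordinate, and $\Delta_n^{i,\epsilon}=\mathcal{VR}(\mathbb{I}_n^{(i,\epsilon)};3)$. Define $\partial(\Delta_n)=\bigcup_{i\in[n],\,\epsilon\in\{0,1\}}\Delta_n^{i,\epsilon}$. -}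

module Defs where

open import Data.Bool using (Bool; true; false)
open import Data.Nat using (ℕ; zero; suc; _+_; _*_; _≤_; _<_)
open import Data.Integer using (ℤ; -_; _-_) renaming (_+_ to _+ℤ_; _*_ to _*ℤ_; +_ to pos)
open import Data.List using (List; []; _∷_; length; map; concatMap; upTo)
open import Data.List.Relation.Unary.All using (All)
open import Data.List.Relation.Unary.AllPairs using (AllPairs)
open import Data.Vec using (Vec; []; _∷_; lookup)
open import Data.Fin using (Fin)
open import Data.Product using (Σ; _×_; ∃)
open import Relation.Binary.PropositionalEquality using (_≡_; _≢_)

Vertex : ℕ → Set
Vertex n = Vec Bool n

-- Hamming distance (number of differing coordinates) = graph distance in I_n.
differ : Bool → Bool → ℕ
differ true  true  = 0
differ false false = 0
differ _     _     = 1

dist : ∀ {n} → Vertex n → Vertex n → ℕ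
dist []       []       = 0
dist (a ∷ u) (b ∷ v) = differ a b + dist u v

allVertices : (n : ℕ) → List (Vertex n)
allVertices zero    = [] ∷ []
allVertices (suc n) = concatMap (λ v → (false ∷ v) ∷ (true ∷ v) ∷ []) (allVertices n)

-- A fixed total order on vertices (via binary code), used to orient simplices:
-- a p-simplex is represented by the strictly increasing list of its p+1 vertices.
bit : Bool → ℕ
bit false = 0
bit true  = 1

code : ∀ {n} → Vertex n → ℕ
code []      = 0
code (b ∷ v) = bit b + 2 * code v

_≺_ : ∀ {n} → Vertex n → Vertex n → Set
u ≺ v = code u < code v

IsSimplex : (n p : ℕ) → List (Vertex n) → Set
IsSimplex n p σ = (length σ ≡ suc p) × AllPairs _≺_ σ × AllPairs (λ u v → dist u v ≤ 3) σ

Chain : ℕ → Set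
Chain n = List (Vertex n) → ℤ

-- c is a p-chain of Δ_n: supported on p-simplices of Δ_n (finite support is automatic).
IsChain : (n p : ℕ) → Chain n → Set
IsChain n p c = ∀ σ → c σ ≢ pos 0 → IsSimplex n p σ

sum : List ℤ → ℤ
sum []       = pos 0
sum (x ∷ xs) = x +ℤ sum xs

sgn : ℕ → ℤ
sgn zero    = pos 1
sgn (suc i) = - sgn i

insertAt : ∀ {A : Set} → ℕ → A → List A → List A
insertAt zero    a xs       = a ∷ xs
insertAt (suc i) a []       = a ∷ []
insertAt (suc i) a (x ∷ xs) = x ∷ insertAt i a xs

-- Since c is supported on strictly increasing lists, this is the usual
-- ∂[v₀,…,v_p] = Σ_i (-1)^i [v₀,…,v̂_i,…,v_p].
bd : ∀ {n} → Chain n → Chain n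
bd {n} c τ = sum (concatMap (λ v → map (λ i → sgn i *ℤ c (insertAt i v τ)) (upTo (suc (length τ))))
                            (allVertices n))

-- p-cycles (unaugmented complex: every 0-chain is a cycle).
IsCycle : (n p : ℕ) → Chain n → Set
IsCycle n zero    c = Data.Unit.⊤ where import Data.Unit
IsCycle n (suc p) c = ∀ τ → bd c τ ≡ pos 0

-- σ ∈ ∂(Δ_n) : all vertices of σ lie in a common facet I_n^{(i,ε)}.
InBoundary : (n : ℕ) → List (Vertex n) → Set
InBoundary n σ = Σ (Fin n) λ i → Σ Bool λ ε → All (λ v → lookup v i ≡ ε) σ

SupportedInBoundary : (n : ℕ) → Chain n → Set
SupportedInBoundary n c = ∀ σ → c σ ≢ pos 0 → InBoundary n σ

module Submission where

-- A set of k vertices of the cube with pairwise distances at most 3 and k + 2 ≤ n lies in a facet: otherwise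
-- every coordinate of a vertex v₀ is changed by another vertex, and counting coordinates against the vertex v₁
-- farthest from v₀ (at most 3 where v₁ moves, at most one for each further vertex) gives n ≤ k + 1.
-- Hence for p + 3 ≤ n every p-simplex of Δₙ already lies in ∂Δₙ. For 2 ≤ p ≤ n - 2, a p-simplex
-- σ = {v₀, …, v_p} not in ∂Δₙ has v₁, …, v_p in a facet x(i) = ¬ v₀(i); the neighbour w of v₀ across i is close
-- to all of σ, and every face of the cone w ∗ σ other than σ lies in ∂Δₙ. Coning each such σ off at its apex,
-- c - ∂(Σ_σ c(σ) · w ∗ σ) is a cycle homologous to c and supported in ∂Δₙ.

open import Defs
open import Data.Nat using (ℕ; suc; _≤_; _∸_)
open import Data.Integer using (_-_)
open import Data.Product using (Σ; _×_)
open import Relation.Binary.PropositionalEquality using (_≡_)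

open import Data.Bool using (Bool; true; false; not)
import Data.Bool.Properties as Bool
open import Data.Empty using (⊥; ⊥-elim)
open import Data.Fin as Fin using (Fin)
import Data.Fin.Properties as Fin
open import Data.Integer using (ℤ; 0ℤ; 1ℤ; -_) renaming (_+_ to _⊕_; _*_ to _⊗_)
import Data.Integer.Properties as ℤ
open import Data.Integer.Tactic.RingSolver using (solve-∀)
open import Data.List using (List; []; _∷_; length; map; concatMap; upTo; _++_)
open import Data.List.Extrema.Nat using (argmax; argmax-all; f[⊥]≤f[argmax]; f[xs]≤f[argmax])
open import Data.List.Membership.Propositional using (_∈_; _∉_)
open import Data.List.Membership.Propositional.Properties using (∈-upTo⁺; ∈-upTo⁻)
import Data.List.Properties as List
open import Data.List.Relation.Unary.All as All using (All; []; _∷_)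
open import Data.List.Relation.Unary.All.Properties.Core using (¬All⇒Any¬)
open import Data.List.Relation.Unary.AllPairs as AllPairs using (AllPairs; []; _∷_)
open import Data.List.Relation.Unary.Any as Any using (Any; here; there)
import Data.List.Relation.Unary.Any.Properties as Any
open import Data.List.Relation.Unary.Unique.Propositional using (Unique)
import Data.List.Relation.Unary.Unique.Propositional.Properties as Unique
open import Data.Maybe using (Maybe; just; nothing)
import Data.Maybe.Properties as Maybe
open import Data.Nat using (zero; pred; _+_; _*_; _<_; z≤n; s≤s; _≤?_; _<?_)
open import Data.Nat.ListAction using () renaming (sum to sumℕ)
import Data.Nat.Properties as ℕ
open import Data.Nat.Tactic.RingSolver using () renaming (solve-∀ to ℕ-solve-∀)
open import Data.Product using (_,_; proj₁; proj₂; ∃; ∃₂)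
open import Data.Sum as Sum using (_⊎_; inj₁; inj₂)
open import Data.Unit using (tt)
open import Data.Vec using ([]; _∷_; lookup; head; tail; updateAt)
import Data.Vec.Properties as Vec
open import Function using (_∘_)
open import Relation.Binary.Definitions using (tri<; tri≈; tri>)
open import Relation.Binary.PropositionalEquality
  using (refl; sym; trans; cong; cong₂; subst; _≢_; ≢-sym; module ≡-Reasoning)
open import Relation.Nullary using (¬_; Dec; _because_; yes; no)
open import Relation.Nullary.Decidable using (_×-dec_)

open ≡-Reasoning

-- Finite sums

private variable
  A B P Q : Set

syntax ∑ xs (λ x → e) = ∑[ x ∈ xs ] e

opaque
  ∑ : {A : Set} → List A → (A → ℤ) → ℤ
  ∑ xs f = sum (map f xs)

  sum-map : (xs : List A) (f : A → ℤ) → sum (map f xs) ≡ ∑ xs f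
  sum-map xs f = refl

  ∑-[] : (f : A → ℤ) → ∑ [] f ≡ 0ℤ
  ∑-[] f = refl

  ∑-∷ : (x : A) (xs : List A) (f : A → ℤ) → ∑ (x ∷ xs) f ≡ f x ⊕ ∑ xs f
  ∑-∷ x xs f = refl

  ∑-cong : (xs : List A) {f g : A → ℤ} → (∀ x → x ∈ xs → f x ≡ g x) → ∑ xs f ≡ ∑ xs g
  ∑-cong []       eq = refl
  ∑-cong (x ∷ xs) eq = cong₂ _⊕_ (eq x (here refl)) (∑-cong xs (λ y y∈xs → eq y (there y∈xs)))

  ∑-zero : (xs : List A) {f : A → ℤ} → (∀ x → x ∈ xs → f x ≡ 0ℤ) → ∑ xs f ≡ 0ℤ
  ∑-zero []       eq = refl
  ∑-zero (x ∷ xs) eq = cong₂ _⊕_ (eq x (here refl)) (∑-zero xs (λ y y∈xs → eq y (there y∈xs)))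

  ∑-distrib-+ : (xs : List A) (f g : A → ℤ) → ∑[ x ∈ xs ] (f x ⊕ g x) ≡ ∑ xs f ⊕ ∑ xs g
  ∑-distrib-+ []       f g = refl
  ∑-distrib-+ (x ∷ xs) f g =
    trans (cong (f x ⊕ g x ⊕_) (∑-distrib-+ xs f g)) (interchange (f x) (g x) (∑ xs f) (∑ xs g))
    where
    interchange : ∀ a b c d → a ⊕ b ⊕ (c ⊕ d) ≡ a ⊕ c ⊕ (b ⊕ d)
    interchange = solve-∀

  ∑-neg : (xs : List A) (f : A → ℤ) → ∑[ x ∈ xs ] (- f x) ≡ - ∑ xs f
  ∑-neg []       f = refl
  ∑-neg (x ∷ xs) f = trans (cong (- f x ⊕_) (∑-neg xs f)) (sym (ℤ.neg-distrib-+ (f x) (∑ xs f)))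

  ∑-distrib-− : (xs : List A) (f g : A → ℤ) → ∑[ x ∈ xs ] (f x - g x) ≡ ∑ xs f - ∑ xs g
  ∑-distrib-− xs f g = trans (∑-distrib-+ xs f (-_ ∘ g)) (cong (∑ xs f ⊕_) (∑-neg xs g))

  ∑-*ˡ : (xs : List A) (a : ℤ) (f : A → ℤ) → ∑[ x ∈ xs ] (a ⊗ f x) ≡ a ⊗ ∑ xs f
  ∑-*ˡ []       a f = sym (ℤ.*-zeroʳ a)
  ∑-*ˡ (x ∷ xs) a f = trans (cong (a ⊗ f x ⊕_) (∑-*ˡ xs a f)) (sym (ℤ.*-distribˡ-+ a (f x) (∑ xs f)))

  ∑-*ʳ : (xs : List A) (f : A → ℤ) (a : ℤ) → ∑[ x ∈ xs ] (f x ⊗ a) ≡ ∑ xs f ⊗ a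
  ∑-*ʳ []       f a = sym (ℤ.*-zeroˡ a)
  ∑-*ʳ (x ∷ xs) f a = trans (cong (f x ⊗ a ⊕_) (∑-*ʳ xs f a)) (sym (ℤ.*-distribʳ-+ a (f x) (∑ xs f)))

  ∑-comm : (xs : List A) (ys : List B) (f : A → B → ℤ) →
           ∑[ x ∈ xs ] ∑[ y ∈ ys ] f x y ≡ ∑[ y ∈ ys ] ∑[ x ∈ xs ] f x y
  ∑-comm []       ys f = sym (∑-zero ys (λ _ _ → refl))
  ∑-comm (x ∷ xs) ys f =
    trans (cong (∑ ys (f x) ⊕_) (∑-comm xs ys f)) (sym (∑-distrib-+ ys (f x) (λ y → ∑[ x′ ∈ xs ] f x′ y)))

  ∑≢0⇒∃≢0 : (xs : List A) (f : A → ℤ) → ∑ xs f ≢ 0ℤ → ∃₂ λ x (_ : x ∈ xs) → f x ≢ 0ℤ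
  ∑≢0⇒∃≢0 []       f ∑≢0 = ⊥-elim (∑≢0 refl)
  ∑≢0⇒∃≢0 (x ∷ xs) f ∑≢0 with f x ℤ.≟ 0ℤ
  ... | no fx≢0 = x , here refl , fx≢0
  ... | yes fx≡0 with ∑≢0⇒∃≢0 xs f (λ ∑≡0 → ∑≢0 (cong₂ _⊕_ fx≡0 ∑≡0))
  ...   | y , y∈xs , fy≢0 = y , there y∈xs , fy≢0

  ∑-single : {xs : List A} {f : A → ℤ} {a : A} → Unique xs → a ∈ xs →
             (∀ x → x ∈ xs → x ≢ a → f x ≡ 0ℤ) → ∑ xs f ≡ f a
  ∑-single {xs = x ∷ xs} {f} (x≢xs ∷ _) (here refl) others =
    trans (cong (f x ⊕_) (∑-zero xs (λ y y∈xs → others y (there y∈xs) (≢-sym (All.lookup x≢xs y∈xs)))))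
          (ℤ.+-identityʳ (f x))
  ∑-single {xs = x ∷ xs} {f} (x≢xs ∷ uniq) (there a∈xs) others =
    trans (cong (_⊕ ∑ xs f) (others x (here refl) (All.lookup x≢xs a∈xs)))
          (trans (ℤ.+-identityˡ (∑ xs f)) (∑-single uniq a∈xs (λ y y∈xs → others y (there y∈xs))))

  sum-++ : (xs ys : List ℤ) → sum (xs ++ ys) ≡ sum xs ⊕ sum ys
  sum-++ []       ys = sym (ℤ.+-identityˡ (sum ys))
  sum-++ (x ∷ xs) ys = trans (cong (x ⊕_) (sum-++ xs ys)) (sym (ℤ.+-assoc x (sum xs) (sum ys)))

  sum-concatMap : (xs : List A) (g : A → List ℤ) → sum (concatMap g xs) ≡ ∑[ x ∈ xs ] sum (g x)
  sum-concatMap []       g = refl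
  sum-concatMap (x ∷ xs) g = trans (sum-++ (g x) (concatMap g xs)) (cong (sum (g x) ⊕_) (sum-concatMap xs g))

  ∑-concatMap : (xs : List A) (g : A → List B) (f : B → ℤ) → ∑ (concatMap g xs) f ≡ ∑[ x ∈ xs ] ∑ (g x) f
  ∑-concatMap xs g f = trans (cong sum (List.map-concatMap f g xs)) (sum-concatMap xs (map f ∘ g))

  ∑-map : (xs : List A) (g : A → B) (f : B → ℤ) → ∑ (map g xs) f ≡ ∑ xs (f ∘ g)
  ∑-map xs g f = cong sum (sym (List.map-∘ xs))

  ∑-upTo-suc : (m : ℕ) (f : ℕ → ℤ) → ∑ (upTo (suc m)) f ≡ f 0 ⊕ ∑ (upTo m) (f ∘ suc)
  ∑-upTo-suc m f =
    cong (f 0 ⊕_) (trans (cong (λ is → ∑ is f) (sym (List.map-upTo suc m))) (∑-map (upTo m) suc f))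

𝟙 : Dec P → ℤ
𝟙 (true  because _) = 1ℤ
𝟙 (false because _) = 0ℤ

𝟙-yes : P → (P? : Dec P) → 𝟙 P? ≡ 1ℤ
𝟙-yes p (yes _) = refl
𝟙-yes p (no ¬p) = ⊥-elim (¬p p)

𝟙-no : ¬ P → (P? : Dec P) → 𝟙 P? ≡ 0ℤ
𝟙-no ¬p (yes p) = ⊥-elim (¬p p)
𝟙-no ¬p (no _)  = refl

𝟙*≢0⇒ : (P? : Dec P) (x : ℤ) → 𝟙 P? ⊗ x ≢ 0ℤ → P
𝟙*≢0⇒ (yes p) x _  = p
𝟙*≢0⇒ (no _)  x ≢0 = ⊥-elim (≢0 (ℤ.*-zeroˡ x))

𝟙-cong : (P → Q) → (Q → P) → (P? : Dec P) (Q? : Dec Q) → 𝟙 P? ≡ 𝟙 Q?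
𝟙-cong P⇒Q Q⇒P (yes p) Q? = sym (𝟙-yes (P⇒Q p) Q?)
𝟙-cong P⇒Q Q⇒P (no ¬p) Q? = sym (𝟙-no (¬p ∘ Q⇒P) Q?)

∑-upTo-split : ∀ m i (h : ℕ → ℤ) → i < m →
  ∑ (upTo (suc m)) h ≡ ∑[ j ∈ upTo m ] (𝟙 (j ≤? i) ⊗ h j) ⊕ ∑[ j ∈ upTo m ] (𝟙 (i ≤? j) ⊗ h (suc j))
∑-upTo-split (suc m) zero h _ = begin
    ∑ (upTo (suc (suc m))) h
  ≡⟨ ∑-upTo-suc (suc m) h ⟩
    h 0 ⊕ ∑ (upTo (suc m)) (h ∘ suc)
  ≡⟨ cong₂ _⊕_ (sym (trans (ℤ.+-identityʳ (1ℤ ⊗ h 0)) (ℤ.*-identityˡ (h 0))))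
               (∑-cong (upTo (suc m)) (λ j _ → sym (ℤ.*-identityˡ (h (suc j))))) ⟩
    (1ℤ ⊗ h 0 ⊕ 0ℤ) ⊕ ∑[ j ∈ upTo (suc m) ] (1ℤ ⊗ h (suc j))
  ≡⟨ cong (λ s → (1ℤ ⊗ h 0 ⊕ s) ⊕ ∑[ j ∈ upTo (suc m) ] (1ℤ ⊗ h (suc j)))
          (sym (∑-zero (upTo m) (λ j _ → ℤ.*-zeroˡ (h (suc (suc j)))))) ⟩
    (1ℤ ⊗ h 0 ⊕ ∑[ j ∈ upTo m ] (𝟙 (suc j ≤? 0) ⊗ h (suc j))) ⊕ ∑[ j ∈ upTo (suc m) ] (1ℤ ⊗ h (suc j))
  ≡⟨ cong (_⊕ ∑[ j ∈ upTo (suc m) ] (1ℤ ⊗ h (suc j))) (sym (∑-upTo-suc m (λ j → 𝟙 (j ≤? 0) ⊗ h j))) ⟩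
    ∑[ j ∈ upTo (suc m) ] (𝟙 (j ≤? 0) ⊗ h j) ⊕ ∑[ j ∈ upTo (suc m) ] (𝟙 (0 ≤? j) ⊗ h (suc j))
  ∎
∑-upTo-split (suc m) (suc i) h (s≤s i<m) = begin
    ∑ (upTo (suc (suc m))) h
  ≡⟨ ∑-upTo-suc (suc m) h ⟩
    h 0 ⊕ ∑ (upTo (suc m)) (h ∘ suc)
  ≡⟨ cong (h 0 ⊕_) (∑-upTo-split m i (h ∘ suc) i<m) ⟩
    h 0 ⊕ (∑[ j ∈ upTo m ] (𝟙 (j ≤? i) ⊗ h (suc j)) ⊕ ∑[ j ∈ upTo m ] (𝟙 (i ≤? j) ⊗ h (suc (suc j))))
  ≡⟨ regroup (h 0) (h 1) _ _ ⟩
    (1ℤ ⊗ h 0 ⊕ ∑[ j ∈ upTo m ] (𝟙 (j ≤? i) ⊗ h (suc j)))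
      ⊕ (0ℤ ⊗ h 1 ⊕ ∑[ j ∈ upTo m ] (𝟙 (i ≤? j) ⊗ h (suc (suc j))))
  ≡⟨ cong₂ (λ s t → (1ℤ ⊗ h 0 ⊕ s) ⊕ (0ℤ ⊗ h 1 ⊕ t))
           (∑-cong (upTo m) (λ j _ → cong (_⊗ h (suc j)) (𝟙-≤?-suc j i)))
           (∑-cong (upTo m) (λ j _ → cong (_⊗ h (suc (suc j))) (𝟙-≤?-suc i j))) ⟩
    (1ℤ ⊗ h 0 ⊕ ∑[ j ∈ upTo m ] (𝟙 (suc j ≤? suc i) ⊗ h (suc j)))
      ⊕ (0ℤ ⊗ h 1 ⊕ ∑[ j ∈ upTo m ] (𝟙 (suc i ≤? suc j) ⊗ h (suc (suc j))))
  ≡⟨ sym (cong₂ _⊕_ (∑-upTo-suc m (λ j → 𝟙 (j ≤? suc i) ⊗ h j))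
                    (∑-upTo-suc m (λ j → 𝟙 (suc i ≤? j) ⊗ h (suc j)))) ⟩
    ∑[ j ∈ upTo (suc m) ] (𝟙 (j ≤? suc i) ⊗ h j) ⊕ ∑[ j ∈ upTo (suc m) ] (𝟙 (suc i ≤? j) ⊗ h (suc j))
  ∎
  where
  regroup : ∀ a b c d → a ⊕ (c ⊕ d) ≡ (1ℤ ⊗ a ⊕ c) ⊕ (0ℤ ⊗ b ⊕ d)
  regroup = solve-∀
  𝟙-≤?-suc : ∀ j k → 𝟙 (j ≤? k) ≡ 𝟙 (suc j ≤? suc k)
  𝟙-≤?-suc j k = 𝟙-cong s≤s ℕ.≤-pred (j ≤? k) (suc j ≤? suc k)

sumℕ-map-+ : (f g : A → ℕ) (xs : List A) → sumℕ (map (λ x → f x + g x) xs) ≡ sumℕ (map f xs) + sumℕ (map g xs)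
sumℕ-map-+ f g []       = refl
sumℕ-map-+ f g (x ∷ xs) = trans (cong (f x + g x +_) (sumℕ-map-+ f g xs))
                               (interchange (f x) (g x) (sumℕ (map f xs)) (sumℕ (map g xs)))
  where
  interchange : ∀ a b c d → a + b + (c + d) ≡ a + c + (b + d)
  interchange = ℕ-solve-∀

1≤sumℕ : (f : A → ℕ) {xs : List A} → Any (λ x → 1 ≤ f x) xs → 1 ≤ sumℕ (map f xs)
1≤sumℕ f {x ∷ xs} (here 1≤fx) = ℕ.≤-trans 1≤fx (ℕ.m≤m+n (f x) _)
1≤sumℕ f {x ∷ xs} (there any) = ℕ.≤-trans (1≤sumℕ f any) (ℕ.m≤n+m _ (f x))

sumℕ≤length : (f : A → ℕ) {xs : List A} → All (λ x → f x ≤ 1) xs → sumℕ (map f xs) ≤ length xs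
sumℕ≤length f []          = z≤n
sumℕ≤length f (fx≤1 ∷ fs) = ℕ.+-mono-≤ fx≤1 (sumℕ≤length f fs)

sumℕ<length : (f : A → ℕ) {xs : List A} → All (λ x → f x ≤ 1) xs → Any (λ x → f x ≡ 0) xs →
              sumℕ (map f xs) < length xs
sumℕ<length f {_ ∷ xs} (fx≤1 ∷ fs) (here fx≡0) =
  s≤s (ℕ.≤-trans (ℕ.≤-reflexive (cong (_+ sumℕ (map f xs)) fx≡0)) (sumℕ≤length f fs))
sumℕ<length f (fx≤1 ∷ fs) (there any) = ℕ.≤-trans (s≤s (ℕ.+-monoˡ-≤ _ fx≤1)) (s≤s (sumℕ<length f fs any))

length-insertAt : ∀ i (x : A) xs → length (insertAt i x xs) ≡ suc (length xs)
length-insertAt zero    x xs       = refl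
length-insertAt (suc i) x []       = refl
length-insertAt (suc i) x (y ∷ xs) = cong suc (length-insertAt i x xs)

insertAt-comm : ∀ i j (x y : A) xs → i ≤ j → j ≤ length xs →
                insertAt i x (insertAt j y xs) ≡ insertAt (suc j) y (insertAt i x xs)
insertAt-comm zero    j       x y xs       _         _         = refl
insertAt-comm (suc i) (suc j) x y (z ∷ xs) (s≤s i≤j) (s≤s j≤l) = cong (z ∷_) (insertAt-comm i j x y xs i≤j j≤l)

-- Indexed by ℕ like insertAt, unlike Data.List.removeAt.
removeAt : ℕ → List A → List A
removeAt _       []       = []
removeAt zero    (x ∷ xs) = xs
removeAt (suc j) (x ∷ xs) = x ∷ removeAt j xs

elemAt : ℕ → List A → Maybe A
elemAt _       []       = nothing
elemAt zero    (x ∷ xs) = just x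
elemAt (suc j) (x ∷ xs) = elemAt j xs

removeAt-insertAt : ∀ i (x : A) xs → i ≤ length xs → removeAt i (insertAt i x xs) ≡ xs
removeAt-insertAt zero    x xs       _         = refl
removeAt-insertAt (suc i) x (y ∷ xs) (s≤s i≤l) = cong (y ∷_) (removeAt-insertAt i x xs i≤l)

elemAt-insertAt : ∀ i (x : A) xs → i ≤ length xs → elemAt i (insertAt i x xs) ≡ just x
elemAt-insertAt zero    x xs       _         = refl
elemAt-insertAt (suc i) x (y ∷ xs) (s≤s i≤l) = elemAt-insertAt i x xs i≤l

elemAt-just : ∀ k (xs : List A) → k < length xs → ∃ λ x → elemAt k xs ≡ just x
elemAt-just zero    (x ∷ xs) _         = x , refl
elemAt-just (suc k) (x ∷ xs) (s≤s k<l) = elemAt-just k xs k<l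

insertAt-removeAt : ∀ i {x : A} xs → elemAt i xs ≡ just x → insertAt i x (removeAt i xs) ≡ xs
insertAt-removeAt zero    (y ∷ xs) refl = refl
insertAt-removeAt (suc i) (y ∷ xs) eq   = cong (y ∷_) (insertAt-removeAt i xs eq)

removeAt-insertAt-< : ∀ j i (x : A) xs → j < i → i ≤ length xs →
                      removeAt j (insertAt i x xs) ≡ insertAt (pred i) x (removeAt j xs)
removeAt-insertAt-< zero    (suc i)       x (y ∷ xs) _         _         = refl
removeAt-insertAt-< (suc j) (suc (suc i)) x (y ∷ xs) (s≤s j<i) (s≤s i≤l) =
  cong (y ∷_) (removeAt-insertAt-< j (suc i) x xs j<i i≤l)

removeAt-insertAt-> : ∀ j i (x : A) xs → i < j → j ≤ length xs →
                      removeAt j (insertAt i x xs) ≡ insertAt i x (removeAt (pred j) xs)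
removeAt-insertAt-> (suc j)       zero    x xs       _         _         = refl
removeAt-insertAt-> (suc (suc j)) (suc i) x (y ∷ xs) (s≤s i<j) (s≤s j≤l) =
  cong (y ∷_) (removeAt-insertAt-> (suc j) i x xs i<j j≤l)

length-removeAt : ∀ j (xs : List A) → j < length xs → suc (length (removeAt j xs)) ≡ length xs
length-removeAt zero    (x ∷ xs) _         = refl
length-removeAt (suc j) (x ∷ xs) (s≤s j<l) = cong suc (length-removeAt j xs j<l)

∈-insertAt : ∀ i (x : A) xs → x ∈ insertAt i x xs
∈-insertAt zero    x xs       = here refl
∈-insertAt (suc i) x []       = here refl
∈-insertAt (suc i) x (y ∷ xs) = there (∈-insertAt i x xs)

∈⇒removeAt : ∀ {xs : List A} {y} → y ∈ xs →
             ∃₂ λ j (_ : j < length xs) → ∀ z → z ∈ xs → z ≡ y ⊎ z ∈ removeAt j xs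
∈⇒removeAt (here refl) = 0 , s≤s z≤n , λ { z (here z≡y) → inj₁ z≡y ; z (there z∈) → inj₂ z∈ }
∈⇒removeAt (there y∈) with ∈⇒removeAt y∈
... | j , j<l , split =
  suc j , s≤s j<l , λ { z (here z≡x) → inj₂ (here z≡x) ; z (there z∈) → Sum.map₂ there (split z z∈) }

module _ {P : A → Set} where

  All-insertAt⁺ : ∀ i {x} xs → P x → All P xs → All P (insertAt i x xs)
  All-insertAt⁺ zero    xs       px pxs         = px ∷ pxs
  All-insertAt⁺ (suc i) []       px []          = px ∷ []
  All-insertAt⁺ (suc i) (y ∷ xs) px (py ∷ pxs)  = py ∷ All-insertAt⁺ i xs px pxs

  All-insertAt⁻ : ∀ i {x} xs → All P (insertAt i x xs) → All P xs
  All-insertAt⁻ zero    xs       (_ ∷ pxs)  = pxs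
  All-insertAt⁻ (suc i) []       _          = []
  All-insertAt⁻ (suc i) (y ∷ xs) (py ∷ pxs) = py ∷ All-insertAt⁻ i xs pxs

  All-removeAt : ∀ j {xs} → All P xs → All P (removeAt j xs)
  All-removeAt j       []         = []
  All-removeAt zero    (_ ∷ pxs)  = pxs
  All-removeAt (suc j) (px ∷ pxs) = px ∷ All-removeAt j pxs

module _ {R : A → A → Set} where

  AllPairs-insertAt⁺ : ∀ i {x} xs → All (R x) xs → All (λ y → R y x) xs → AllPairs R xs →
                       AllPairs R (insertAt i x xs)
  AllPairs-insertAt⁺ zero    xs       Rx  _         Rxs        = Rx ∷ Rxs
  AllPairs-insertAt⁺ (suc i) []       _   _         _          = [] ∷ []
  AllPairs-insertAt⁺ (suc i) (y ∷ xs) (_ ∷ Rx) (Ryx ∷ xR) (Ry ∷ Rxs) =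
    All-insertAt⁺ i xs Ryx Ry ∷ AllPairs-insertAt⁺ i xs Rx xR Rxs

  AllPairs-insertAt⁻ : ∀ i {x} xs → AllPairs R (insertAt i x xs) → AllPairs R xs
  AllPairs-insertAt⁻ zero    xs       (_ ∷ Rxs)  = Rxs
  AllPairs-insertAt⁻ (suc i) []       _          = []
  AllPairs-insertAt⁻ (suc i) (y ∷ xs) (Ry ∷ Rxs) = All-insertAt⁻ i xs Ry ∷ AllPairs-insertAt⁻ i xs Rxs

  AllPairs-removeAt : ∀ j {xs} → AllPairs R xs → AllPairs R (removeAt j xs)
  AllPairs-removeAt j       []         = []
  AllPairs-removeAt zero    (_ ∷ Rxs)  = Rxs
  AllPairs-removeAt (suc j) (Rx ∷ Rxs) = All-removeAt j Rx ∷ AllPairs-removeAt j Rxs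

AllPairs-∈ : {R : A → A → Set} → (∀ x → R x x) → (∀ x y → R x y → R y x) →
             ∀ {xs x y} → AllPairs R xs → x ∈ xs → y ∈ xs → R x y
AllPairs-∈ refl′ sym′ (_  ∷ _)   (here refl) (here refl) = refl′ _
AllPairs-∈ refl′ sym′ (Rx ∷ _)   (here refl) (there y∈)  = All.lookup Rx y∈
AllPairs-∈ refl′ sym′ (Rx ∷ _)   (there x∈)  (here refl) = sym′ _ _ (All.lookup Rx x∈)
AllPairs-∈ refl′ sym′ (_  ∷ Rxs) (there x∈)  (there y∈)  = AllPairs-∈ refl′ sym′ Rxs x∈ y∈

-- The simplicial boundary

sgn*sgn : ∀ i → sgn i ⊗ sgn i ≡ 1ℤ
sgn*sgn zero    = refl
sgn*sgn (suc i) = trans (neg*neg (sgn i)) (sgn*sgn i)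
  where
  neg*neg : ∀ a → - a ⊗ - a ≡ a ⊗ a
  neg*neg = solve-∀

sgn*sgn* : ∀ i x → sgn i ⊗ (sgn i ⊗ x) ≡ x
sgn*sgn* i x = trans (sym (ℤ.*-assoc (sgn i) (sgn i) x)) (trans (cong (_⊗ x) (sgn*sgn i)) (ℤ.*-identityˡ x))

module _ {n : ℕ} where

  private
    V : List (Vertex n)
    V = allVertices n

  bd-expand : (c : Chain n) (τ : List (Vertex n)) →
              bd c τ ≡ ∑[ v ∈ V ] ∑[ i ∈ upTo (suc (length τ)) ] (sgn i ⊗ c (insertAt i v τ))
  bd-expand c τ = trans (sum-concatMap V _) (∑-cong V (λ v _ → sum-map (upTo (suc (length τ))) _))

  bd-zero : (τ : List (Vertex n)) → bd {n} (λ _ → 0ℤ) τ ≡ 0ℤ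
  bd-zero τ = trans (bd-expand (λ _ → 0ℤ) τ)
    (∑-zero V (λ v _ → ∑-zero (upTo (suc (length τ))) (λ i _ → ℤ.*-zeroʳ (sgn i))))

  bd-linear : (c e : Chain n) (τ : List (Vertex n)) → bd (λ σ → c σ - e σ) τ ≡ bd c τ - bd e τ
  bd-linear c e τ = begin
      bd (λ σ → c σ - e σ) τ
    ≡⟨ bd-expand (λ σ → c σ - e σ) τ ⟩
      ∑[ v ∈ V ] ∑[ i ∈ I ] (sgn i ⊗ (c (insertAt i v τ) - e (insertAt i v τ)))
    ≡⟨ ∑-cong V (λ v _ → ∑-cong I (λ i _ → *-distribˡ-− (sgn i) (c (insertAt i v τ)) (e (insertAt i v τ)))) ⟩
      ∑[ v ∈ V ] ∑[ i ∈ I ] (sgn i ⊗ c (insertAt i v τ) - sgn i ⊗ e (insertAt i v τ))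
    ≡⟨ ∑-cong V (λ v _ → ∑-distrib-− I _ _) ⟩
      ∑[ v ∈ V ] (∑[ i ∈ I ] (sgn i ⊗ c (insertAt i v τ)) - ∑[ i ∈ I ] (sgn i ⊗ e (insertAt i v τ)))
    ≡⟨ ∑-distrib-− V _ _ ⟩
      ∑[ v ∈ V ] ∑[ i ∈ I ] (sgn i ⊗ c (insertAt i v τ)) - ∑[ v ∈ V ] ∑[ i ∈ I ] (sgn i ⊗ e (insertAt i v τ))
    ≡⟨ sym (cong₂ _-_ (bd-expand c τ) (bd-expand e τ)) ⟩
      bd c τ - bd e τ
    ∎
    where
    I = upTo (suc (length τ))
    *-distribˡ-− : ∀ a b c → a ⊗ (b - c) ≡ a ⊗ b - a ⊗ c
    *-distribˡ-− = solve-∀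

  bd-bd : (c : Chain n) (τ : List (Vertex n)) → bd (bd c) τ ≡ 0ℤ
  bd-bd c τ = begin
      bd (bd c) τ
    ≡⟨ bd-expand (bd c) τ ⟩
      ∑[ v ∈ V ] ∑[ i ∈ I ] (sgn i ⊗ bd c (insertAt i v τ))
    ≡⟨ ∑-cong V (λ v _ → ∑-cong I (λ i _ → expand-inner v i)) ⟩
      ∑[ v ∈ V ] ∑[ i ∈ I ] ∑[ u ∈ V ] ∑[ j ∈ upTo (suc (suc L)) ] term v u i j
    ≡⟨ ∑-cong V (λ v _ → ∑-comm I V _) ⟩
      ∑[ v ∈ V ] ∑[ u ∈ V ] ∑[ i ∈ I ] ∑[ j ∈ upTo (suc (suc L)) ] term v u i j
    ≡⟨ ∑-cong V (λ v _ → ∑-cong V (λ u _ → antisymmetrise v u)) ⟩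
      ∑[ v ∈ V ] ∑[ u ∈ V ] (below v u - below u v)
    ≡⟨ ∑-cong V (λ v _ → ∑-distrib-− V _ _) ⟩
      ∑[ v ∈ V ] (∑[ u ∈ V ] below v u - ∑[ u ∈ V ] below u v)
    ≡⟨ ∑-distrib-− V _ _ ⟩
      ∑[ v ∈ V ] ∑[ u ∈ V ] below v u - ∑[ v ∈ V ] ∑[ u ∈ V ] below u v
    ≡⟨ cong (λ s → ∑[ v ∈ V ] ∑[ u ∈ V ] below v u - s) (∑-comm V V (λ v u → below u v)) ⟩
      ∑[ v ∈ V ] ∑[ u ∈ V ] below v u - ∑[ u ∈ V ] ∑[ v ∈ V ] below u v
    ≡⟨ ℤ.+-inverseʳ (∑[ v ∈ V ] ∑[ u ∈ V ] below v u) ⟩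
      0ℤ
    ∎
    where
    L = length τ
    I = upTo (suc L)

    term : Vertex n → Vertex n → ℕ → ℕ → ℤ
    term v u i j = sgn i ⊗ (sgn j ⊗ c (insertAt j u (insertAt i v τ)))

    below : Vertex n → Vertex n → ℤ
    below v u = ∑[ i ∈ I ] ∑[ j ∈ I ] (𝟙 (j ≤? i) ⊗ term v u i j)

    expand-inner : ∀ v i → sgn i ⊗ bd c (insertAt i v τ) ≡ ∑[ u ∈ V ] ∑[ j ∈ upTo (suc (suc L)) ] term v u i j
    expand-inner v i = begin
        sgn i ⊗ bd c (insertAt i v τ)
      ≡⟨ cong (sgn i ⊗_) (bd-expand c (insertAt i v τ)) ⟩
        sgn i ⊗ ∑[ u ∈ V ] ∑[ j ∈ upTo (suc (length (insertAt i v τ))) ] (sgn j ⊗ c (insertAt j u (insertAt i v τ)))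
      ≡⟨ cong (λ l → sgn i ⊗ ∑[ u ∈ V ] ∑[ j ∈ upTo (suc l) ] (sgn j ⊗ c (insertAt j u (insertAt i v τ))))
              (length-insertAt i v τ) ⟩
        sgn i ⊗ ∑[ u ∈ V ] ∑[ j ∈ upTo (suc (suc L)) ] (sgn j ⊗ c (insertAt j u (insertAt i v τ)))
      ≡⟨ sym (∑-*ˡ V (sgn i) _) ⟩
        ∑[ u ∈ V ] (sgn i ⊗ ∑[ j ∈ upTo (suc (suc L)) ] (sgn j ⊗ c (insertAt j u (insertAt i v τ))))
      ≡⟨ ∑-cong V (λ u _ → sym (∑-*ˡ (upTo (suc (suc L))) (sgn i) _)) ⟩
        ∑[ u ∈ V ] ∑[ j ∈ upTo (suc (suc L)) ] term v u i j
      ∎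

    -- Inserting v at i and then u at j + 1 > i is inserting u at j and then v at i, with the opposite sign.
    above≡-below : ∀ v u i j → j ∈ I → 𝟙 (i ≤? j) ⊗ term v u i (suc j) ≡ - (𝟙 (i ≤? j) ⊗ term u v j i)
    above≡-below v u i j j∈I with i ≤? j
    ... | yes i≤j = begin
        1ℤ ⊗ (sgn i ⊗ (- sgn j ⊗ c (insertAt (suc j) u (insertAt i v τ))))
      ≡⟨ cong (λ σ → 1ℤ ⊗ (sgn i ⊗ (- sgn j ⊗ c σ)))
              (sym (insertAt-comm i j v u τ i≤j (ℕ.≤-pred (∈-upTo⁻ j∈I)))) ⟩
        1ℤ ⊗ (sgn i ⊗ (- sgn j ⊗ c (insertAt i v (insertAt j u τ))))
      ≡⟨ flip-sign (sgn i) (sgn j) _ ⟩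
        - (1ℤ ⊗ term u v j i)
      ∎
      where
      flip-sign : ∀ a b x → 1ℤ ⊗ (a ⊗ (- b ⊗ x)) ≡ - (1ℤ ⊗ (b ⊗ (a ⊗ x)))
      flip-sign = solve-∀
    ... | no _ = trans (ℤ.*-zeroˡ (term v u i (suc j))) (sym (cong -_ (ℤ.*-zeroˡ (term u v j i))))

    antisymmetrise : ∀ v u → ∑[ i ∈ I ] ∑[ j ∈ upTo (suc (suc L)) ] term v u i j ≡ below v u - below u v
    antisymmetrise v u = begin
        ∑[ i ∈ I ] ∑[ j ∈ upTo (suc (suc L)) ] term v u i j
      ≡⟨ ∑-cong I (λ i i∈I → ∑-upTo-split (suc L) i (term v u i) (∈-upTo⁻ i∈I)) ⟩
        ∑[ i ∈ I ] (∑[ j ∈ I ] (𝟙 (j ≤? i) ⊗ term v u i j) ⊕ ∑[ j ∈ I ] (𝟙 (i ≤? j) ⊗ term v u i (suc j)))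
      ≡⟨ ∑-distrib-+ I _ _ ⟩
        below v u ⊕ ∑[ i ∈ I ] ∑[ j ∈ I ] (𝟙 (i ≤? j) ⊗ term v u i (suc j))
      ≡⟨ cong (below v u ⊕_) (∑-cong I (λ i _ → trans (∑-cong I (above≡-below v u i)) (∑-neg I _))) ⟩
        below v u ⊕ ∑[ i ∈ I ] (- ∑[ j ∈ I ] (𝟙 (i ≤? j) ⊗ term u v j i))
      ≡⟨ cong (below v u ⊕_) (trans (∑-neg I _) (cong -_ (∑-comm I I _))) ⟩
        below v u - below u v
      ∎

∑-allVertices-single : ∀ n {f : Vertex n → ℤ} w → (∀ v → v ≢ w → f v ≡ 0ℤ) → ∑ (allVertices n) f ≡ f w
∑-allVertices-single zero    {f} [] _ =
  trans (∑-∷ [] [] f) (trans (cong (f [] ⊕_) (∑-[] f)) (ℤ.+-identityʳ (f [])))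
∑-allVertices-single (suc n) {f} (b ∷ w) off-w = begin
    ∑ (allVertices (suc n)) f
  ≡⟨ ∑-concatMap (allVertices n) (λ v → (false ∷ v) ∷ (true ∷ v) ∷ []) f ⟩
    ∑[ v ∈ allVertices n ] ∑ ((false ∷ v) ∷ (true ∷ v) ∷ []) f
  ≡⟨ ∑-cong (allVertices n) (λ v _ → pair v) ⟩
    ∑[ v ∈ allVertices n ] (f (false ∷ v) ⊕ f (true ∷ v))
  ≡⟨ ∑-allVertices-single n w (λ v v≢w → cong₂ _⊕_ (off-w (false ∷ v) (v≢w ∘ Vec.∷-injectiveʳ))
                                                    (off-w (true ∷ v) (v≢w ∘ Vec.∷-injectiveʳ))) ⟩
    f (false ∷ w) ⊕ f (true ∷ w)
  ≡⟨ at-w b off-w ⟩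
    f (b ∷ w)
  ∎
  where
  pair : ∀ v → ∑ ((false ∷ v) ∷ (true ∷ v) ∷ []) f ≡ f (false ∷ v) ⊕ f (true ∷ v)
  pair v = trans (∑-∷ _ _ f) (cong (f (false ∷ v) ⊕_)
             (trans (∑-∷ _ _ f) (trans (cong (f (true ∷ v) ⊕_) (∑-[] f)) (ℤ.+-identityʳ (f (true ∷ v))))))
  at-w : ∀ b → (∀ v → v ≢ b ∷ w → f v ≡ 0ℤ) → f (false ∷ w) ⊕ f (true ∷ w) ≡ f (b ∷ w)
  at-w false off = trans (cong (f (false ∷ w) ⊕_) (off (true ∷ w) (λ ()))) (ℤ.+-identityʳ _)
  at-w true  off = trans (cong (_⊕ f (true ∷ w)) (off (false ∷ w) (λ ()))) (ℤ.+-identityˡ _)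

code-injective : ∀ {n} (u v : Vertex n) → code u ≡ code v → u ≡ v
code-injective []          []          _  = refl
code-injective (false ∷ u) (false ∷ v) eq =
  cong (false ∷_) (code-injective u v (ℕ.*-cancelˡ-≡ (code u) (code v) 2 eq))
code-injective (true  ∷ u) (true  ∷ v) eq =
  cong (true ∷_) (code-injective u v (ℕ.*-cancelˡ-≡ (code u) (code v) 2 (ℕ.suc-injective eq)))
code-injective (false ∷ u) (true  ∷ v) eq = ⊥-elim (ℕ.even≢odd (code u) (code v) eq)
code-injective (true  ∷ u) (false ∷ v) eq = ⊥-elim (ℕ.even≢odd (code v) (code u) (sym eq))

Sorted : ∀ {n} → List (Vertex n) → Set
Sorted = AllPairs _≺_

Sorted? : ∀ {n} (σ : List (Vertex n)) → Dec (Sorted σ)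
Sorted? = AllPairs.allPairs? (λ u v → code u <? code v)

∑-Sorted-insertAt : ∀ {n} (w : Vertex n) σ → Sorted σ → w ∉ σ →
                    ∑[ i ∈ upTo (suc (length σ)) ] 𝟙 (Sorted? (insertAt i w σ)) ≡ 1ℤ
∑-Sorted-insertAt w []      _          _   =
  trans (∑-upTo-suc 0 _) (trans (cong (1ℤ ⊕_) (∑-[] _)) (ℤ.+-identityʳ 1ℤ))
∑-Sorted-insertAt w (x ∷ σ) (x≺σ ∷ σ↑) w∉ with ℕ.<-cmp (code w) (code x)
... | tri< w≺x _ _ = begin
    ∑[ i ∈ upTo (suc (suc (length σ))) ] 𝟙 (Sorted? (insertAt i w (x ∷ σ)))
  ≡⟨ ∑-upTo-suc (suc (length σ)) _ ⟩
    𝟙 (Sorted? (w ∷ x ∷ σ)) ⊕ ∑[ i ∈ upTo (suc (length σ)) ] 𝟙 (Sorted? (x ∷ insertAt i w σ))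
  ≡⟨ cong₂ _⊕_ (𝟙-yes ((w≺x ∷ All.map (ℕ.<-trans w≺x) x≺σ) ∷ x≺σ ∷ σ↑) (Sorted? (w ∷ x ∷ σ)))
               (∑-zero (upTo (suc (length σ))) (λ i _ → 𝟙-no (x⊀w i) (Sorted? (x ∷ insertAt i w σ)))) ⟩
    1ℤ ⊕ 0ℤ
  ∎
  where
  x⊀w : ∀ i → ¬ Sorted (x ∷ insertAt i w σ)
  x⊀w i (x≺ ∷ _) = ℕ.<-asym w≺x (All.lookup x≺ (∈-insertAt i w σ))
... | tri≈ _ w≡x _ = ⊥-elim (w∉ (here (code-injective w x w≡x)))
... | tri> _ _ x≺w = begin
    ∑[ i ∈ upTo (suc (suc (length σ))) ] 𝟙 (Sorted? (insertAt i w (x ∷ σ)))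
  ≡⟨ ∑-upTo-suc (suc (length σ)) _ ⟩
    𝟙 (Sorted? (w ∷ x ∷ σ)) ⊕ ∑[ i ∈ upTo (suc (length σ)) ] 𝟙 (Sorted? (x ∷ insertAt i w σ))
  ≡⟨ cong₂ _⊕_ (𝟙-no (λ { ((w≺x ∷ _) ∷ _) → ℕ.<-asym x≺w w≺x }) (Sorted? (w ∷ x ∷ σ)))
               (∑-cong (upTo (suc (length σ))) (λ i _ →
                  𝟙-cong (λ { (_ ∷ sorted) → sorted }) (λ sorted → All-insertAt⁺ i σ x≺w x≺σ ∷ sorted)
                         (Sorted? (x ∷ insertAt i w σ)) (Sorted? (insertAt i w σ)))) ⟩
    0ℤ ⊕ ∑[ i ∈ upTo (suc (length σ)) ] 𝟙 (Sorted? (insertAt i w σ))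
  ≡⟨ trans (ℤ.+-identityˡ _) (∑-Sorted-insertAt w σ σ↑ (w∉ ∘ there)) ⟩
    1ℤ
  ∎

IsSimplex? : ∀ {n} p (σ : List (Vertex n)) → Dec (IsSimplex n p σ)
IsSimplex? p σ = (length σ ℕ.≟ suc p) ×-dec (Sorted? σ ×-dec AllPairs.allPairs? (λ u v → dist u v ≤? 3) σ)

IsSimplex-insertAt⁻ : ∀ {n p} i v (σ : List (Vertex n)) → IsSimplex n (suc p) (insertAt i v σ) → IsSimplex n p σ
IsSimplex-insertAt⁻ i v σ (length≡ , sorted , clique) =
  ℕ.suc-injective (trans (sym (length-insertAt i v σ)) length≡) ,
  AllPairs-insertAt⁻ i σ sorted , AllPairs-insertAt⁻ i σ clique

bd-IsChain : ∀ {n p} {d : Chain n} → IsChain n (suc p) d → IsChain n p (bd d)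
bd-IsChain {n} {d = d} d-chain σ bdσ≢0
  with ∑≢0⇒∃≢0 (allVertices n) (λ v → ∑[ i ∈ upTo (suc (length σ)) ] (sgn i ⊗ d (insertAt i v σ)))
               (bdσ≢0 ∘ trans (bd-expand d σ))
... | v , _ , ∑≢0 with ∑≢0⇒∃≢0 (upTo (suc (length σ))) (λ i → sgn i ⊗ d (insertAt i v σ)) ∑≢0
...   | i , _ , term≢0 = IsSimplex-insertAt⁻ i v σ (d-chain (insertAt i v σ) (term≢0 ∘ d≡0⇒term≡0))
  where
  d≡0⇒term≡0 : d (insertAt i v σ) ≡ 0ℤ → sgn i ⊗ d (insertAt i v σ) ≡ 0ℤ
  d≡0⇒term≡0 d≡0 = trans (cong (sgn i ⊗_) d≡0) (ℤ.*-zeroʳ (sgn i))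

IsChain-− : ∀ {n p} {c e : Chain n} → IsChain n p c → IsChain n p e → IsChain n p (λ σ → c σ - e σ)
IsChain-− {c = c} {e} c-chain e-chain σ c-e≢0 with c σ ℤ.≟ 0ℤ
... | no  cσ≢0 = c-chain σ cσ≢0
... | yes cσ≡0 = e-chain σ λ eσ≡0 → c-e≢0 (cong₂ _-_ cσ≡0 eσ≡0)

IsCycle⇒bd≡0 : ∀ {n} p {c : Chain n} → 1 ≤ p → IsCycle n p c → ∀ τ → bd c τ ≡ 0ℤ
IsCycle⇒bd≡0 (suc p) _ cycle = cycle

bd≡0⇒IsCycle : ∀ {n} p {c : Chain n} → (∀ τ → bd c τ ≡ 0ℤ) → IsCycle n p c
bd≡0⇒IsCycle zero    _    = tt
bd≡0⇒IsCycle (suc p) bd≡0 = bd≡0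

-- Hamming geometry of the cube

differ-sym : ∀ a b → differ a b ≡ differ b a
differ-sym true  true  = refl
differ-sym true  false = refl
differ-sym false true  = refl
differ-sym false false = refl

dist-sym : ∀ {n} (u v : Vertex n) → dist u v ≡ dist v u
dist-sym []      []      = refl
dist-sym (a ∷ u) (b ∷ v) = cong₂ _+_ (differ-sym a b) (dist-sym u v)

dist-self : ∀ {n} (u : Vertex n) → dist u u ≡ 0
dist-self []          = refl
dist-self (true ∷ u)  = dist-self u
dist-self (false ∷ u) = dist-self u

Near : ∀ {n} → Vertex n → Vertex n → Set
Near u v = dist u v ≤ 3

Near-refl : ∀ {n} (u : Vertex n) → Near u u
Near-refl u = ℕ.≤-trans (ℕ.≤-reflexive (dist-self u)) z≤n

Near-sym : ∀ {n} (u v : Vertex n) → Near u v → Near v u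
Near-sym u v = ℕ.≤-trans (ℕ.≤-reflexive (dist-sym v u))

extraBit : Bool → Bool → Bool → ℕ
extraBit b₀ b₁ b = differ b b₀ * (1 ∸ differ b₁ b₀)

extra : ∀ {n} → Vertex n → Vertex n → Vertex n → ℕ
extra []        []        []      = 0
extra (b₀ ∷ v₀) (b₁ ∷ v₁) (b ∷ x) = extraBit b₀ b₁ b + extra v₀ v₁ x

extra-self : ∀ {n} (v₀ v₁ : Vertex n) → extra v₀ v₁ v₁ ≡ 0
extra-self []        []        = refl
extra-self (b₀ ∷ v₀) (b₁ ∷ v₁) = cong₂ _+_ (diagonal b₀ b₁) (extra-self v₀ v₁)
  where
  diagonal : ∀ b₀ b₁ → extraBit b₀ b₁ b₁ ≡ 0
  diagonal true  true  = refl
  diagonal true  false = refl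
  diagonal false true  = refl
  diagonal false false = refl

extra-identity : ∀ {n} (v₀ v₁ x : Vertex n) → 2 * extra v₀ v₁ x + dist v₁ v₀ ≡ dist x v₀ + dist x v₁
extra-identity []        []        []      = refl
extra-identity (b₀ ∷ v₀) (b₁ ∷ v₁) (b ∷ x) = begin
    2 * (extraBit b₀ b₁ b + extra v₀ v₁ x) + (differ b₁ b₀ + dist v₁ v₀)
  ≡⟨ regroup (extraBit b₀ b₁ b) (extra v₀ v₁ x) (differ b₁ b₀) (dist v₁ v₀) ⟩
    (2 * extraBit b₀ b₁ b + differ b₁ b₀) + (2 * extra v₀ v₁ x + dist v₁ v₀)
  ≡⟨ cong₂ _+_ (coordinate b₀ b₁ b) (extra-identity v₀ v₁ x) ⟩
    (differ b b₀ + differ b b₁) + (dist x v₀ + dist x v₁)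
  ≡⟨ regroup′ (differ b b₀) (differ b b₁) (dist x v₀) (dist x v₁) ⟩
    (differ b b₀ + dist x v₀) + (differ b b₁ + dist x v₁)
  ∎
  where
  regroup : ∀ e E d D → 2 * (e + E) + (d + D) ≡ (2 * e + d) + (2 * E + D)
  regroup = ℕ-solve-∀
  regroup′ : ∀ a b c d → (a + b) + (c + d) ≡ (a + c) + (b + d)
  regroup′ = ℕ-solve-∀
  coordinate : ∀ b₀ b₁ b → 2 * extraBit b₀ b₁ b + differ b₁ b₀ ≡ differ b b₀ + differ b b₁
  coordinate true  true  true  = refl
  coordinate true  true  false = refl
  coordinate true  false true  = refl
  coordinate true  false false = refl
  coordinate false true  true  = refl
  coordinate false true  false = refl
  coordinate false false true  = refl
  coordinate false false false = refl

-- By extra-identity, 2 · extra v₀ v₁ x ≤ dist x v₁ ≤ 3.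
extra≤1 : ∀ {n} (v₀ v₁ x : Vertex n) → dist x v₀ ≤ dist v₁ v₀ → Near x v₁ → extra v₀ v₁ x ≤ 1
extra≤1 v₀ v₁ x x≤v₁ near = half (ℕ.+-cancelʳ-≤ (dist v₁ v₀) (2 * extra v₀ v₁ x) 3 bound)
  where
  bound : 2 * extra v₀ v₁ x + dist v₁ v₀ ≤ 3 + dist v₁ v₀
  bound = ℕ.≤-trans (ℕ.≤-reflexive (extra-identity v₀ v₁ x))
            (ℕ.≤-trans (ℕ.+-mono-≤ x≤v₁ near) (ℕ.≤-reflexive (ℕ.+-comm (dist v₁ v₀) 3)))
  half : ∀ {e} → 2 * e ≤ 3 → e ≤ 1
  half {zero}        _  = z≤n
  half {suc zero}    _  = ℕ.≤-refl
  half {suc (suc e)} le with ℕ.≤-trans (ℕ.*-monoʳ-≤ 2 (s≤s (s≤s (z≤n {e})))) le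
  ... | s≤s (s≤s (s≤s ()))

Escapes : ∀ {n} → Vertex n → List (Vertex n) → Set
Escapes {n} v₀ xs = (i : Fin n) → Any (λ x → lookup x i ≢ lookup v₀ i) xs

-- A coordinate where v₁ differs from v₀ is counted in the distance, any other one by some extra.
n≤dist+∑extra : ∀ {n} (v₀ v₁ : Vertex n) (xs : List (Vertex n)) → Escapes v₀ xs →
                n ≤ dist v₁ v₀ + sumℕ (map (extra v₀ v₁) xs)
n≤dist+∑extra []        []        xs escapes = z≤n
n≤dist+∑extra {suc n} (b₀ ∷ v₀) (b₁ ∷ v₁) xs escapes =
  ℕ.≤-trans (ℕ.+-mono-≤ (first b₀ b₁ (escapes Fin.zero)) rest) (ℕ.≤-reflexive regroup)
  where
  S₀ S : ℕ
  S₀ = sumℕ (map (extraBit b₀ b₁ ∘ head) xs)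
  S  = sumℕ (map (extra v₀ v₁ ∘ tail) xs)

  moved : ∀ b₀ b → b ≢ b₀ → 1 ≤ extraBit b₀ b₀ b
  moved true  true  b≢b₀ = ⊥-elim (b≢b₀ refl)
  moved true  false _    = ℕ.≤-refl
  moved false true  _    = ℕ.≤-refl
  moved false false b≢b₀ = ⊥-elim (b≢b₀ refl)

  first : ∀ b₀ b₁ → Any (λ x → lookup x Fin.zero ≢ b₀) xs → 1 ≤ differ b₁ b₀ + sumℕ (map (extraBit b₀ b₁ ∘ head) xs)
  first true  true  any = 1≤sumℕ _ (Any.map (λ { {b ∷ _} b≢b₀ → moved true b b≢b₀ }) any)
  first false false any = 1≤sumℕ _ (Any.map (λ { {b ∷ _} b≢b₀ → moved false b b≢b₀ }) any)
  first true  false _   = s≤s z≤n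
  first false true  _   = s≤s z≤n

  rest : n ≤ dist v₁ v₀ + S
  rest = ℕ.≤-trans (n≤dist+∑extra v₀ v₁ (map tail xs) tails-escape)
                   (ℕ.≤-reflexive (cong ((dist v₁ v₀ +_) ∘ sumℕ) (sym (List.map-∘ xs))))
    where
    tails-escape : Escapes v₀ (map tail xs)
    tails-escape i = Any.map⁺ (Any.map (λ { {_ ∷ _} ne → ne }) (escapes (Fin.suc i)))

  extra-∷ : ∀ x → extra (b₀ ∷ v₀) (b₁ ∷ v₁) x ≡ extraBit b₀ b₁ (head x) + extra v₀ v₁ (tail x)
  extra-∷ (_ ∷ _) = refl

  regroup : (differ b₁ b₀ + S₀) + (dist v₁ v₀ + S) ≡
            differ b₁ b₀ + dist v₁ v₀ + sumℕ (map (extra (b₀ ∷ v₀) (b₁ ∷ v₁)) xs)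
  regroup = trans (interchange (differ b₁ b₀) S₀ (dist v₁ v₀) S)
                  (cong (differ b₁ b₀ + dist v₁ v₀ +_)
                        (sym (trans (cong sumℕ (List.map-cong extra-∷ xs)) (sumℕ-map-+ _ _ xs))))
    where
    interchange : ∀ a b c d → a + b + (c + d) ≡ a + c + (b + d)
    interchange = ℕ-solve-∀

-- With v₁ farthest from v₀, every vertex of xs but v₁ has at most one extra coordinate, so n ≤ 3 + (length xs - 1).
¬Escapes : ∀ {n} (v₀ : Vertex n) (xs : List (Vertex n)) → All (Near v₀) xs → AllPairs Near xs →
           3 + length xs ≤ n → ¬ Escapes v₀ xs
¬Escapes {suc _} v₀ []       _      _      _   escapes with escapes Fin.zero
... | ()
¬Escapes         v₀ (x ∷ xs) v₀-near clique len escapes =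
  ℕ.<-irrefl refl (ℕ.≤-trans (ℕ.+-monoʳ-≤ 3 ∑extra<length)
                  (ℕ.≤-trans len (ℕ.≤-trans (n≤dist+∑extra v₀ v₁ (x ∷ xs) escapes) (ℕ.+-monoˡ-≤ _ v₁-near))))
  where
  v₁ : Vertex _
  v₁ = argmax (λ y → dist y v₀) x xs

  v₁∈ : v₁ ∈ x ∷ xs
  v₁∈ = argmax-all (λ y → dist y v₀) {P = _∈ x ∷ xs} (here refl) (All.tabulate there)

  farthest : All (λ y → dist y v₀ ≤ dist v₁ v₀) (x ∷ xs)
  farthest = f[⊥]≤f[argmax] {f = λ y → dist y v₀} x xs ∷ f[xs]≤f[argmax] {f = λ y → dist y v₀} x xs

  v₁-near : dist v₁ v₀ ≤ 3
  v₁-near = Near-sym v₀ v₁ (All.lookup v₀-near v₁∈)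

  ∑extra<length : sumℕ (map (extra v₀ v₁) (x ∷ xs)) < length (x ∷ xs)
  ∑extra<length = sumℕ<length (extra v₀ v₁)
    (All.tabulate (λ y∈ → extra≤1 v₀ v₁ _ (All.lookup farthest y∈) (AllPairs-∈ Near-refl Near-sym clique y∈ v₁∈)))
    (Any.map (λ { refl → extra-self v₀ v₁ }) v₁∈)

clique⇒InBoundary : ∀ {n} (xs : List (Vertex n)) → AllPairs Near xs → 2 + length xs ≤ n → InBoundary n xs
clique⇒InBoundary {suc _} []        _                  _   = Fin.zero , true , []
clique⇒InBoundary         (v₀ ∷ xs) (v₀-near ∷ clique) len
  with Fin.any? (λ i → All.all? (λ x → lookup x i Bool.≟ lookup v₀ i) xs)
... | yes (i , constant) = i , lookup v₀ i , refl ∷ constant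
... | no  ¬constant      = ⊥-elim (¬Escapes v₀ xs v₀-near clique len escapes)
  where
  escapes : Escapes v₀ xs
  escapes i = ¬All⇒Any¬ (λ x → lookup x i Bool.≟ lookup v₀ i) xs (λ constant → ¬constant (i , constant))

InBoundary? : ∀ {n} (σ : List (Vertex n)) → Dec (InBoundary n σ)
InBoundary? σ = Fin.any? (λ i → constant? i)
  where
  constant? : ∀ i → Dec (∃ λ ε → All (λ v → lookup v i ≡ ε) σ)
  constant? i with All.all? (λ v → lookup v i Bool.≟ true) σ | All.all? (λ v → lookup v i Bool.≟ false) σ
  ... | yes all-true | _           = yes (true , all-true)
  ... | no _         | yes all-false = yes (false , all-false)
  ... | no ¬true     | no ¬false     =
    no λ { (true , all-true) → ¬true all-true ; (false , all-false) → ¬false all-false }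

InBoundary-insertAt : ∀ {n} i w (σ : List (Vertex n)) → InBoundary n (w ∷ σ) → InBoundary n (insertAt i w σ)
InBoundary-insertAt i w σ (j , ε , w≡ε ∷ σ≡ε) = j , ε , All-insertAt⁺ i σ w≡ε σ≡ε

flipAt : ∀ {n} → Vertex n → Fin n → Vertex n
flipAt v i = updateAt v i not

dist-flipAt-self : ∀ {n} (v : Vertex n) i → dist (flipAt v i) v ≡ 1
dist-flipAt-self (true  ∷ v) Fin.zero    = cong suc (dist-self v)
dist-flipAt-self (false ∷ v) Fin.zero    = cong suc (dist-self v)
dist-flipAt-self (true  ∷ v) (Fin.suc i) = dist-flipAt-self v i
dist-flipAt-self (false ∷ v) (Fin.suc i) = dist-flipAt-self v i

dist-flipAt≤ : ∀ {n} (v y : Vertex n) i → lookup y i ≡ not (lookup v i) → dist (flipAt v i) y ≤ dist v y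
dist-flipAt≤ (true  ∷ v) (_ ∷ y) Fin.zero    refl = ℕ.n≤1+n (dist v y)
dist-flipAt≤ (false ∷ v) (_ ∷ y) Fin.zero    refl = ℕ.n≤1+n (dist v y)
dist-flipAt≤ (b     ∷ v) (c ∷ y) (Fin.suc i) eq   = ℕ.+-monoʳ-≤ (differ b c) (dist-flipAt≤ v y i eq)

Opposite : ∀ {n} → Vertex n → List (Vertex n) → Fin n → Set
Opposite v vs i = All (λ u → lookup u i ≡ not (lookup v i)) vs

Opposite? : ∀ {n} (v : Vertex n) vs → Dec (∃ (Opposite v vs))
Opposite? v vs = Fin.any? (λ i → All.all? (λ u → lookup u i Bool.≟ not (lookup v i)) vs)

apex : ∀ {n} → List (Vertex n) → Maybe (Vertex n)
apex []       = nothing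
apex (v ∷ vs) with Opposite? v vs
... | yes (i , _) = just (flipAt v i)
... | no  _       = nothing

apex-spec : ∀ {n} (v : Vertex n) vs {w} → apex (v ∷ vs) ≡ just w → ∃ λ i → Opposite v vs i × flipAt v i ≡ w
apex-spec v vs eq with Opposite? v vs
... | yes (i , opposite) = i , opposite , Maybe.just-injective eq

apex-near : ∀ {n} {σ : List (Vertex n)} {w} → AllPairs Near σ → apex σ ≡ just w → All (Near w) σ
apex-near {σ = v ∷ vs} (near ∷ _) eq with apex-spec v vs eq
... | i , opposite , refl =
  ℕ.≤-trans (ℕ.≤-reflexive (dist-flipAt-self v i)) (s≤s z≤n)
  ∷ All.zipWith (λ (v-near-u , u-opposite) → ℕ.≤-trans (dist-flipAt≤ v _ i u-opposite) v-near-u) (near , opposite)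

module _ {n p : ℕ} (p+2≤n : 2 + p ≤ n) where

  apex-exists : ∀ σ → IsSimplex n p σ → ¬ InBoundary n σ → ∃ λ w → apex σ ≡ just w
  apex-exists (v ∷ vs) (refl , _ , _ ∷ clique) ¬∂σ with clique⇒InBoundary vs clique p+2≤n
  ... | i , ε , in-facet with Opposite? v vs
  ...   | yes (j , _) = flipAt v j , refl
  ...   | no ¬opposite = ⊥-elim (¬opposite (i , All.map (λ { refl → Bool.¬-not ε≢v }) in-facet))
    where
    ε≢v : ε ≢ lookup v i
    ε≢v ε≡v = ¬∂σ (i , ε , sym ε≡v ∷ in-facet)

  -- Each face w ∪ σ∖{vⱼ} of the cone lies in a facet of the cube: for j = 0 the one opposite to v₀; otherwise one
  -- containing the clique v₀ ∪ σ∖{v₀, vⱼ}, which is not along the flipped coordinate since p ≥ 2 leaves a vertex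
  -- of σ∖{v₀, vⱼ} on the opposite side, and so contains w as well.
  apex-faces : 2 ≤ p → ∀ σ {w} → IsSimplex n p σ → apex σ ≡ just w →
               ∀ j → j < suc p → InBoundary n (w ∷ removeAt j σ)
  apex-faces _ (v ∷ vs) _ eq zero _ with apex-spec v vs eq
  ... | i , opposite , refl = i , not (lookup v i) , Vec.lookup∘updateAt i v ∷ opposite
  apex-faces 2≤p (v ∷ vs) (refl , _ , near ∷ clique) eq (suc j) (s≤s j<p) with apex-spec v vs eq
  ... | i , opposite , refl
    with clique⇒InBoundary (v ∷ removeAt j vs) (All-removeAt j near ∷ AllPairs-removeAt j clique)
                           (ℕ.≤-trans (ℕ.≤-reflexive (cong (2 +_) (length-removeAt j vs j<p))) p+2≤n)
  ...   | i′ , ε , v≡ε ∷ rest≡ε with i′ Fin.≟ i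
  ...     | no  i′≢i = i′ , ε , trans (Vec.lookup∘updateAt′ i′ i i′≢i v) v≡ε ∷ v≡ε ∷ rest≡ε
  ...     | yes refl = ⊥-elim (clash (removeAt j vs) (length-removeAt j vs j<p) rest≡ε (All-removeAt j opposite))
    where
    clash : ∀ us → suc (length us) ≡ p → All (λ u → lookup u i ≡ ε) us → Opposite v us i → ⊥
    clash []      1≡p _         _          with subst (2 ≤_) (sym 1≡p) 2≤p
    ... | s≤s ()
    clash (u ∷ _) _   (u≡ε ∷ _) (u≡¬v ∷ _) = Bool.not-¬ (trans u≡ε (sym v≡ε)) u≡¬v

  apex∉ : 2 ≤ p → ∀ σ {w} → IsSimplex n p σ → ¬ InBoundary n σ → apex σ ≡ just w → w ∉ σ
  apex∉ 2≤p σ σ-simplex ¬∂σ eq w∈σ with ∈⇒removeAt w∈σ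
  ... | j , j<l , split with apex-faces 2≤p σ σ-simplex eq j (subst (j <_) (proj₁ σ-simplex) j<l)
  ...   | i , ε , w≡ε ∷ rest≡ε = ¬∂σ (i , ε , All.tabulate on-facet)
    where
    on-facet : ∀ {z} → z ∈ σ → lookup z i ≡ ε
    on-facet {z} z∈σ with split z z∈σ
    ... | inj₁ refl = w≡ε
    ... | inj₂ z∈   = All.lookup rest≡ε z∈

-- The cone

module Cone {n p : ℕ} (p+2≤n : 2 + p ≤ n) (2≤p : 2 ≤ p) where

  insertApex-faces : ∀ σ k {w} → IsSimplex n p σ → apex σ ≡ just w → k ≤ length σ →
                     ∀ j → j < suc (length σ) → j ≢ k → InBoundary n (removeAt j (insertAt k w σ))
  insertApex-faces σ k {w} σ-simplex apex≡w k≤l j j<l j≢k with ℕ.<-cmp j k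
  ... | tri< j<k _ _ =
    subst (InBoundary n) (sym (removeAt-insertAt-< j k w σ j<k k≤l))
          (InBoundary-insertAt (pred k) w (removeAt j σ)
             (apex-faces p+2≤n 2≤p σ σ-simplex apex≡w j (ℕ.<-≤-trans j<k (subst (k ≤_) (proj₁ σ-simplex) k≤l))))
  ... | tri≈ _ j≡k _ = ⊥-elim (j≢k j≡k)
  ... | tri> _ _ k<j with j | j<l
  ...   | suc j′ | s≤s j′<l =
    subst (InBoundary n) (sym (removeAt-insertAt-> (suc j′) k w σ k<j j′<l))
          (InBoundary-insertAt k w (removeAt j′ σ)
             (apex-faces p+2≤n 2≤p σ σ-simplex apex≡w j′ (subst (j′ <_) (proj₁ σ-simplex) j′<l)))

  IsConeAt : List (Vertex n) → ℕ → Set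
  IsConeAt τ k = IsSimplex n (suc p) τ × apex (removeAt k τ) ≡ elemAt k τ

  IsConeAt? : ∀ τ k → Dec (IsConeAt τ k)
  IsConeAt? τ k = IsSimplex? (suc p) τ ×-dec Maybe.≡-dec (Vec.≡-dec Bool._≟_) (apex (removeAt k τ)) (elemAt k τ)

  IsConeAt-faces : ∀ τ k → k < length τ → IsConeAt τ k →
                   ∀ j → j < length τ → j ≢ k → InBoundary n (removeAt j τ)
  IsConeAt-faces τ k k<l (τ-simplex , apex≡) j j<l j≢k with elemAt-just k τ k<l
  ... | w , elemAt≡w = subst (λ τ → InBoundary n (removeAt j τ)) τ≡
        (insertApex-faces σ k (IsSimplex-insertAt⁻ k w σ (subst (IsSimplex n (suc p)) (sym τ≡) τ-simplex))
                          (trans apex≡ elemAt≡w) (ℕ.≤-pred (subst (k <_) (sym (length-removeAt k τ k<l)) k<l))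
                          j (subst (j <_) (sym (length-removeAt k τ k<l)) j<l) j≢k)
    where
    σ = removeAt k τ
    τ≡ : insertAt k w σ ≡ τ
    τ≡ = insertAt-removeAt k τ elemAt≡w

  IsConeAt-insertAt⇒apex : ∀ σ v i → i ≤ length σ → IsConeAt (insertAt i v σ) i → apex σ ≡ just v
  IsConeAt-insertAt⇒apex σ v i i≤l (_ , apex≡) =
    trans (cong apex (sym (removeAt-insertAt i v σ i≤l))) (trans apex≡ (elemAt-insertAt i v σ i≤l))

  Sorted⇒IsConeAt : ∀ σ {w} i → IsSimplex n p σ → apex σ ≡ just w → i ≤ length σ →
                    Sorted (insertAt i w σ) → IsConeAt (insertAt i w σ) i
  Sorted⇒IsConeAt σ {w} i (length≡ , _ , clique) apex≡w i≤l sorted =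
    ( trans (length-insertAt i w σ) (cong suc length≡)
    , sorted
    , AllPairs-insertAt⁺ i σ (apex-near clique apex≡w) (All.map (Near-sym w _) (apex-near clique apex≡w)) clique )
    , trans (cong apex (removeAt-insertAt i w σ i≤l)) (trans apex≡w (sym (elemAt-insertAt i w σ i≤l)))

  module _ (c : Chain n) where

    -- The sum over p-simplices σ of c σ times apex σ ∪ σ, indexed by the position k of the apex in the
    -- sorted (p+1)-simplex; the sign (-1)^k makes σ appear with coefficient c σ in the boundary.
    cone : Chain n
    cone τ = ∑[ k ∈ upTo (length τ) ] (sgn k ⊗ (𝟙 (IsConeAt? τ k) ⊗ c (removeAt k τ)))

    cone-IsChain : IsChain n (suc p) cone
    cone-IsChain τ cone≢0
      with ∑≢0⇒∃≢0 (upTo (length τ)) (λ k → sgn k ⊗ (𝟙 (IsConeAt? τ k) ⊗ c (removeAt k τ))) cone≢0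
    ... | k , _ , term≢0 = proj₁ (𝟙*≢0⇒ (IsConeAt? τ k) (c (removeAt k τ))
                                   (λ ≡0 → term≢0 (trans (cong (sgn k ⊗_) ≡0) (ℤ.*-zeroʳ (sgn k)))))

    sgn*cone-insertAt : ∀ σ v i → ¬ InBoundary n σ → i ≤ length σ →
                        sgn i ⊗ cone (insertAt i v σ) ≡ 𝟙 (IsConeAt? (insertAt i v σ) i) ⊗ c σ
    sgn*cone-insertAt σ v i ¬∂σ i≤l = begin
        sgn i ⊗ cone τ
      ≡⟨ cong (sgn i ⊗_) (∑-single (Unique.upTo⁺ (length τ)) (∈-upTo⁺ i<l) off-i) ⟩
        sgn i ⊗ (sgn i ⊗ (𝟙 (IsConeAt? τ i) ⊗ c (removeAt i τ)))
      ≡⟨ sgn*sgn* i (𝟙 (IsConeAt? τ i) ⊗ c (removeAt i τ)) ⟩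
        𝟙 (IsConeAt? τ i) ⊗ c (removeAt i τ)
      ≡⟨ cong ((𝟙 (IsConeAt? τ i) ⊗_) ∘ c) (removeAt-insertAt i v σ i≤l) ⟩
        𝟙 (IsConeAt? τ i) ⊗ c σ
      ∎
      where
      τ = insertAt i v σ
      i<l : i < length τ
      i<l = subst (i <_) (sym (length-insertAt i v σ)) (s≤s i≤l)
      off-i : ∀ k → k ∈ upTo (length τ) → k ≢ i → sgn k ⊗ (𝟙 (IsConeAt? τ k) ⊗ c (removeAt k τ)) ≡ 0ℤ
      off-i k k∈ k≢i = trans (cong (λ x → sgn k ⊗ (x ⊗ c (removeAt k τ))) (𝟙-no ¬IsConeAt (IsConeAt? τ k)))
                             (trans (cong (sgn k ⊗_) (ℤ.*-zeroˡ (c (removeAt k τ)))) (ℤ.*-zeroʳ (sgn k)))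
        where
        ¬IsConeAt : ¬ IsConeAt τ k
        ¬IsConeAt cone-at-k = ¬∂σ (subst (InBoundary n) (removeAt-insertAt i v σ i≤l)
                                   (IsConeAt-faces τ k (∈-upTo⁻ k∈) cone-at-k i i<l (≢-sym k≢i)))

    bd-cone : ∀ σ → IsSimplex n p σ → ¬ InBoundary n σ → bd cone σ ≡ c σ
    bd-cone σ σ-simplex@(_ , sorted , _) ¬∂σ with apex-exists p+2≤n σ σ-simplex ¬∂σ
    ... | w , apex≡w = begin
        bd cone σ
      ≡⟨ bd-expand cone σ ⟩
        ∑[ v ∈ allVertices n ] ∑[ i ∈ I ] (sgn i ⊗ cone (insertAt i v σ))
      ≡⟨ ∑-cong (allVertices n) (λ v _ → ∑-cong I (λ i i∈I → sgn*cone-insertAt σ v i ¬∂σ (i≤l i∈I))) ⟩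
        ∑[ v ∈ allVertices n ] ∑[ i ∈ I ] (𝟙 (IsConeAt? (insertAt i v σ) i) ⊗ c σ)
      ≡⟨ ∑-allVertices-single n w (λ v v≢w → ∑-zero I (λ i i∈I → trans
           (cong (_⊗ c σ) (𝟙-no (v≢w ∘ apex-only-w v i∈I) (IsConeAt? (insertAt i v σ) i)))
           (ℤ.*-zeroˡ (c σ)))) ⟩
        ∑[ i ∈ I ] (𝟙 (IsConeAt? (insertAt i w σ) i) ⊗ c σ)
      ≡⟨ ∑-cong I (λ i i∈I → cong (_⊗ c σ) (𝟙-cong (proj₁ ∘ proj₂ ∘ proj₁) (Sorted⇒IsConeAt σ i σ-simplex apex≡w (i≤l i∈I))
                                                   (IsConeAt? (insertAt i w σ) i) (Sorted? (insertAt i w σ)))) ⟩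
        ∑[ i ∈ I ] (𝟙 (Sorted? (insertAt i w σ)) ⊗ c σ)
      ≡⟨ ∑-*ʳ I (λ i → 𝟙 (Sorted? (insertAt i w σ))) (c σ) ⟩
        ∑[ i ∈ I ] 𝟙 (Sorted? (insertAt i w σ)) ⊗ c σ
      ≡⟨ cong (_⊗ c σ) (∑-Sorted-insertAt w σ sorted (apex∉ p+2≤n 2≤p σ σ-simplex ¬∂σ apex≡w)) ⟩
        1ℤ ⊗ c σ
      ≡⟨ ℤ.*-identityˡ (c σ) ⟩
        c σ
      ∎
      where
      I = upTo (suc (length σ))
      i≤l : ∀ {i} → i ∈ I → i ≤ length σ
      i≤l = ℕ.≤-pred ∘ ∈-upTo⁻
      apex-only-w : ∀ v {i} → i ∈ I → IsConeAt (insertAt i v σ) i → v ≡ w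
      apex-only-w v {i} i∈I cone-at-i =
        Maybe.just-injective (trans (sym (IsConeAt-insertAt⇒apex σ v i (i≤l i∈I) cone-at-i)) apex≡w)

HomologousToBoundaryCycle : (n p : ℕ) → Chain n → Set
HomologousToBoundaryCycle n p c =
  Σ (Chain n) λ c′ → IsChain n p c′ × IsCycle n p c′ × SupportedInBoundary n c′ ×
    Σ (Chain n) λ d → IsChain n (suc p) d × (∀ σ → c σ - c′ σ ≡ bd d σ)

IsChain⇒SupportedInBoundary : ∀ {n p} {c : Chain n} → 3 + p ≤ n → IsChain n p c → SupportedInBoundary n c
IsChain⇒SupportedInBoundary {n} 3+p≤n c-chain σ cσ≢0 with c-chain σ cσ≢0
... | length≡ , _ , clique = clique⇒InBoundary σ clique (subst (λ l → 2 + l ≤ n) (sym length≡) 3+p≤n)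

HomologousToBoundaryCycle-refl : ∀ {n p} {c : Chain n} → IsChain n p c → IsCycle n p c → SupportedInBoundary n c →
                                 HomologousToBoundaryCycle n p c
HomologousToBoundaryCycle-refl {c = c} c-chain c-cycle c-support =
  c , c-chain , c-cycle , c-support , (λ _ → 0ℤ) , (λ _ 0≢0 → ⊥-elim (0≢0 refl)) ,
  λ σ → trans (ℤ.+-inverseʳ (c σ)) (sym (bd-zero σ))

HomologousToBoundaryCycle-cone : ∀ {n p} {c : Chain n} → 2 + p ≤ n → 2 ≤ p → IsChain n p c → IsCycle n p c →
                                 HomologousToBoundaryCycle n p c
HomologousToBoundaryCycle-cone {n} {p} {c} p+2≤n 2≤p c-chain c-cycle =
  c′ , c′-chain , bd≡0⇒IsCycle p c′-cycle , c′-support ,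
  cone c , cone-IsChain c , λ σ → a-[a-b]≡b (c σ) (bd (cone c) σ)
  where
  open Cone p+2≤n 2≤p
  c′ : Chain n
  c′ σ = c σ - bd (cone c) σ
  c′-chain : IsChain n p c′
  c′-chain = IsChain-− c-chain (bd-IsChain (cone-IsChain c))
  c′-cycle : ∀ τ → bd c′ τ ≡ 0ℤ
  c′-cycle τ = trans (bd-linear c (bd (cone c)) τ)
                     (cong₂ _-_ (IsCycle⇒bd≡0 p (ℕ.≤-trans (s≤s z≤n) 2≤p) c-cycle τ) (bd-bd (cone c) τ))
  c′-support : SupportedInBoundary n c′
  c′-support σ c′σ≢0 with InBoundary? σ
  ... | yes ∂σ = ∂σ
  ... | no ¬∂σ =
    ⊥-elim (c′σ≢0 (trans (cong (λ x → c σ - x) (bd-cone c σ (c′-chain σ c′σ≢0) ¬∂σ)) (ℤ.+-inverseʳ (c σ))))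
  a-[a-b]≡b : ∀ a b → a - (a - b) ≡ b
  a-[a-b]≡b = solve-∀

lemma4p13 : (n p : ℕ) → 5 ≤ n → p ≤ n ∸ 2 →
    (c : Chain n) → IsChain n p c → IsCycle n p c →
    Σ (Chain n) (λ c' → IsChain n p c' × IsCycle n p c' × SupportedInBoundary n c' ×
      Σ (Chain n) (λ d → IsChain n (suc p) d × (∀ σ → c σ - c' σ ≡ bd d σ)))
lemma4p13 n p 5≤n p≤n∸2 c c-chain c-cycle with 2 ≤? p
... | yes 2≤p = HomologousToBoundaryCycle-cone p+2≤n 2≤p c-chain c-cycle
  where
  p+2≤n : 2 + p ≤ n
  p+2≤n = subst (_≤ n) (ℕ.+-comm p 2) (ℕ.m≤o∸n⇒m+n≤o p (ℕ.≤-trans (s≤s (s≤s z≤n)) 5≤n) p≤n∸2)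
... | no  2≰p = HomologousToBoundaryCycle-refl c-chain c-cycle (IsChain⇒SupportedInBoundary 3+p≤n c-chain)
  where
  3+p≤n : 3 + p ≤ n
  3+p≤n = ℕ.≤-trans (ℕ.+-monoʳ-≤ 3 (ℕ.≤-pred (ℕ.≰⇒> 2≰p))) (ℕ.≤-trans (ℕ.n≤1+n 4) 5≤n)
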